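{- Let $g(x)$ be a formal power series over $\mathbb{C}$ with $g_0=1$ such that the Riordan matrix $(1,xg(x))$ is a pseudo-involution, i.e. the compositional inverse of $xg(x)$ is $xg(-x)$. Let $B(x)$ be its $B$-function, i.e. the formal power series satisfying $g(x)=1+xg(x)B\big(x^2g(x)\big)$. Let $\sqrt{g(x)}$ be the square root of $g$ with constant term $1$, let $h(x)$ be the unique formal power series with $h\big(x\sqrt{g(x)}\big)=\sqrt{g(x)}$ (the generating function of the $A$-sequence of $(1,x\sqrt{g(x)})$), and let $s(x)$ be the series with $h(x)=s(x)+\sqrt{s^2(x)+1}$, i.e. $s(x)=\tfrac12\big(h(x)-h^{ -1}(x)\big)$. Then $$xB(x^2)=2s(x).$$
   Context: For a formal power series $f$ with $f_0=0$, the Riordan matrix $(1,f(x))$ acts on formal power series by $a(x)\mapsto a(f(x))$; $(1,f)^{ -1}=(1,\bar f)$ with $\bar f$ the compositional inverse of $f$. A matrix $(1,xg(x))$ with $g_0=1$ is a pseudo-involution if $(1,xg(x))^{ -1}=(1,xg(-x))$. For such a pseudo-involution there is a unique numerical sequence $(b_n)_{n\ge0}$ (the $B$-sequence) whose generating function $B(x)$ (the $B$-function) satisfies $g(x)=1+xg(x)B(x^2g(x))$. -}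

module Defs where

open import Level using (Level; _⊔_)
open import Data.Nat using (ℕ; zero; suc)
open import Data.Product using (Σ; _×_)
open import Relation.Binary.PropositionalEquality using (_≡_)
open import Relation.Nullary using (¬_)
open import Algebra.Bundles using (CommutativeRing; Semiring)
import Algebra.Definitions.RawSemiring as RSDefs

-- A field of characteristic zero, given as a commutative ring with extra laws
-- (agda-stdlib has no Field bundle).  ℂ is the intended instance.
record IsFieldChar0 {c ℓ : Level} (R : CommutativeRing c ℓ) : Set (c ⊔ ℓ) where
  open CommutativeRing R using (Carrier; _≈_; _*_; 0#; 1#; semiring)
  open RSDefs (Semiring.rawSemiring semiring) using () renaming (_×_ to _·ℕ_)
  field
    1≉0      : ¬ (1# ≈ 0#)
    inverse  : ∀ a → ¬ (a ≈ 0#) → Σ Carrier (λ b → a * b ≈ 1#)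
    char0    : ∀ n → (n ·ℕ 1#) ≈ 0# → n ≡ 0

module FPS {c ℓ : Level} (R : CommutativeRing c ℓ) where
  open CommutativeRing R using (Carrier; _≈_; _+_; _*_; -_; 0#; 1#)

  Series : Set c
  Series = ℕ → Carrier

  _≈ₛ_ : Series → Series → Set ℓ
  a ≈ₛ b = ∀ n → a n ≈ b n

  const : Carrier → Series
  const a zero    = a
  const a (suc n) = 0#

  𝟘 𝟙 : Series
  𝟘 = const 0#
  𝟙 = const 1#

  X : Series
  X zero          = 0#
  X (suc zero)    = 1#
  X (suc (suc n)) = 0#

  _⊕_ : Series → Series → Series
  (a ⊕ b) n = a n + b n

  ⊖_ : Series → Series
  (⊖ a) n = - (a n)

  sumTo : ℕ → (ℕ → Carrier) → Carrier
  sumTo zero    f = f zero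
  sumTo (suc n) f = sumTo n f + f (suc n)

  _⊗_ : Series → Series → Series
  (a ⊗ b) n = sumTo n (λ i → a i * b (n ∸' i))
    where
    _∸'_ : ℕ → ℕ → ℕ
    m       ∸' zero    = m
    zero    ∸' suc k   = zero
    suc m   ∸' suc k   = m ∸' k

  _^ₛ_ : Series → ℕ → Series
  a ^ₛ zero  = 𝟙
  a ^ₛ suc k = a ⊗ (a ^ₛ k)

  -- composition a(f(x)) = Σ_k a_k f(x)^k ; meaningful when f_0 = 0,
  -- in which case the coefficient of x^n only involves k ≤ n.
  _∘ₛ_ : Series → Series → Series
  (a ∘ₛ f) n = sumTo n (λ k → a k * (f ^ₛ k) n)

  neg-arg : Series → Series
  neg-arg g = g ∘ₛ (⊖ X)

  IsCompInverse : Series → Series → Set ℓ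
  IsCompInverse f f̄ = (f 0 ≈ 0#) × (f̄ 0 ≈ 0#) × ((f ∘ₛ f̄) ≈ₛ X) × ((f̄ ∘ₛ f) ≈ₛ X)

  IsPseudoInvolution : Series → Set ℓ
  IsPseudoInvolution g = (g 0 ≈ 1#) × IsCompInverse (X ⊗ g) (X ⊗ neg-arg g)

  IsBFunction : Series → Series → Set ℓ
  IsBFunction g B = g ≈ₛ (𝟙 ⊕ ((X ⊗ g) ⊗ (B ∘ₛ ((X ⊗ X) ⊗ g))))

  IsSqrt1 : Series → Series → Set ℓ
  IsSqrt1 a r = (r 0 ≈ 1#) × ((r ⊗ r) ≈ₛ a)

-- Substitute w = x√g, which is compositionally invertible since w₀ = 0 and w₁ = 1.
-- For S = s(w) and T = t(w) the defining property of h gives √g = S + T with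
-- T² = S² + 1, hence g = (S + T)² = 1 + 2√g S. On the other hand x g = √g w and
-- x² g = w², so the B-equation reads g = 1 + √g w B(w²). Cancelling √g gives
-- 2 s(w) = w B(w²) = (x B(x²))(w), and composition with w is injective.
module Submission where

open import Defs
open import Level using (Level)
open import Data.Nat as ℕ using (ℕ; zero; suc; _∸_; _≤_; _<_; z≤n; s≤s)
import Data.Nat.Properties as ℕ
open import Data.Product using (_,_)
open import Data.Sum using (inj₁; inj₂)
open import Relation.Binary.PropositionalEquality as ≡ using (_≡_; _≢_)
open import Function using (_∘_)
open import Relation.Nullary using (contradiction)
open import Algebra.Bundles using (CommutativeRing)
import Algebra.Properties.AbelianGroup as AbelianGroupProperties
import Algebra.Properties.CommutativeSemigroup as CommutativeSemigroupProperties
import Algebra.Solver.Ring.NaturalCoefficients.Default as NaturalSolver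

module Sums {c ℓ : Level} (R : CommutativeRing c ℓ) where
  open CommutativeRing R
  open FPS R using (sumTo)
  open CommutativeSemigroupProperties +-commutativeSemigroup using (interchange)
  open import Relation.Binary.Reasoning.Setoid setoid

  sumTo-cong-≤ : ∀ n {f g : ℕ → Carrier} → (∀ i → i ≤ n → f i ≈ g i) → sumTo n f ≈ sumTo n g
  sumTo-cong-≤ zero    f≈g = f≈g 0 z≤n
  sumTo-cong-≤ (suc n) f≈g =
    +-cong (sumTo-cong-≤ n (λ i i≤n → f≈g i (ℕ.m≤n⇒m≤1+n i≤n))) (f≈g (suc n) ℕ.≤-refl)

  sumTo-cong : ∀ n {f g : ℕ → Carrier} → (∀ i → f i ≈ g i) → sumTo n f ≈ sumTo n g
  sumTo-cong n f≈g = sumTo-cong-≤ n (λ i _ → f≈g i)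

  sumTo-zero : ∀ n {f : ℕ → Carrier} → (∀ i → i ≤ n → f i ≈ 0#) → sumTo n f ≈ 0#
  sumTo-zero zero    f≈0 = f≈0 0 z≤n
  sumTo-zero (suc n) f≈0 = trans
    (+-cong (sumTo-zero n (λ i i≤n → f≈0 i (ℕ.m≤n⇒m≤1+n i≤n))) (f≈0 (suc n) ℕ.≤-refl))
    (+-identityʳ 0#)

  sumTo-+ : ∀ n (f g : ℕ → Carrier) → sumTo n (λ i → f i + g i) ≈ sumTo n f + sumTo n g
  sumTo-+ zero    f g = refl
  sumTo-+ (suc n) f g = trans (+-congʳ (sumTo-+ n f g)) (interchange _ _ _ _)

  *-distribˡ-sumTo : ∀ n x (f : ℕ → Carrier) → x * sumTo n f ≈ sumTo n (λ i → x * f i)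
  *-distribˡ-sumTo zero    x f = refl
  *-distribˡ-sumTo (suc n) x f = trans (distribˡ x _ _) (+-congʳ (*-distribˡ-sumTo n x f))

  *-distribʳ-sumTo : ∀ n x (f : ℕ → Carrier) → sumTo n f * x ≈ sumTo n (λ i → f i * x)
  *-distribʳ-sumTo zero    x f = refl
  *-distribʳ-sumTo (suc n) x f = trans (distribʳ x _ _) (+-congʳ (*-distribʳ-sumTo n x f))

  sumTo-*-sumTo : ∀ n m (f g : ℕ → Carrier) →
    sumTo n f * sumTo m g ≈ sumTo n (λ i → sumTo m (λ j → f i * g j))
  sumTo-*-sumTo n m f g =
    trans (*-distribʳ-sumTo n _ f) (sumTo-cong n (λ i → *-distribˡ-sumTo m (f i) g))

  sumTo-suc : ∀ n (f : ℕ → Carrier) → sumTo (suc n) f ≈ f 0 + sumTo n (λ i → f (suc i))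
  sumTo-suc zero    f = refl
  sumTo-suc (suc n) f = trans (+-congʳ (sumTo-suc n f)) (+-assoc _ _ _)

  sumTo-comm : ∀ n m (F : ℕ → ℕ → Carrier) →
    sumTo n (λ i → sumTo m (λ j → F i j)) ≈ sumTo m (λ j → sumTo n (λ i → F i j))
  sumTo-comm zero    m F = refl
  sumTo-comm (suc n) m F = trans (+-congʳ (sumTo-comm n m F))
    (sym (sumTo-+ m (λ j → sumTo n (λ i → F i j)) (F (suc n))))

  sumTo-rotate₃ : ∀ n (F : ℕ → ℕ → ℕ → Carrier) →
    sumTo n (λ i → sumTo n (λ j → sumTo n (λ k → F i j k))) ≈
    sumTo n (λ j → sumTo n (λ k → sumTo n (λ i → F i j k)))
  sumTo-rotate₃ n F = trans (sumTo-comm n n _) (sumTo-cong n (λ j → sumTo-comm n n _))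

  sumTo-rotate₄ : ∀ n (F : ℕ → ℕ → ℕ → ℕ → Carrier) →
    sumTo n (λ i → sumTo n (λ j → sumTo n (λ k → sumTo n (λ l → F i j k l)))) ≈
    sumTo n (λ j → sumTo n (λ k → sumTo n (λ l → sumTo n (λ i → F i j k l))))
  sumTo-rotate₄ n F =
    trans (sumTo-comm n n _) (sumTo-cong n (λ j → sumTo-rotate₃ n (λ i k l → F i j k l)))

  sumTo-extend : ∀ {n} m {f : ℕ → Carrier} → n ≤ m →
    (∀ i → n < i → i ≤ m → f i ≈ 0#) → sumTo n f ≈ sumTo m f
  sumTo-extend zero z≤n _ = refl
  sumTo-extend {n} (suc m) {f} n≤1+m f≈0 with ℕ.m≤n⇒m<n∨m≡n n≤1+m
  ... | inj₂ ≡.refl = refl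
  ... | inj₁ (s≤s n≤m) = begin
    sumTo n f          ≈⟨ sumTo-extend m n≤m (λ i n<i i≤m → f≈0 i n<i (ℕ.m≤n⇒m≤1+n i≤m)) ⟩
    sumTo m f          ≈⟨ +-identityʳ _ ⟨
    sumTo m f + 0#     ≈⟨ +-congˡ (f≈0 (suc m) (s≤s n≤m) ℕ.≤-refl) ⟨
    sumTo (suc m) f    ∎

  δ : ℕ → ℕ → Carrier
  δ zero    zero    = 1#
  δ zero    (suc _) = 0#
  δ (suc _) zero    = 0#
  δ (suc m) (suc n) = δ m n

  δ-self : ∀ m → δ m m ≈ 1#
  δ-self zero    = refl
  δ-self (suc m) = δ-self m

  δ-≢ : ∀ {m n} → m ≢ n → δ m n ≈ 0#
  δ-≢ {zero}  {zero}  m≢n = contradiction ≡.refl m≢n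
  δ-≢ {zero}  {suc n} _   = refl
  δ-≢ {suc m} {zero}  _   = refl
  δ-≢ {suc m} {suc n} m≢n = δ-≢ (m≢n ∘ ≡.cong suc)

  δ-sym : ∀ m n → δ m n ≈ δ n m
  δ-sym zero    zero    = refl
  δ-sym zero    (suc n) = refl
  δ-sym (suc m) zero    = refl
  δ-sym (suc m) (suc n) = δ-sym m n

  δ-+ˡ : ∀ i m n → δ (i ℕ.+ m) (i ℕ.+ n) ≈ δ m n
  δ-+ˡ zero    m n = refl
  δ-+ˡ (suc i) m n = δ-+ˡ i m n

  δ-< : ∀ {m n} → m < n → δ m n ≈ 0#
  δ-< m<n = δ-≢ (ℕ.<⇒≢ m<n)

  δ-> : ∀ {m n} → n < m → δ m n ≈ 0#
  δ-> n<m = δ-≢ (ℕ.>⇒≢ n<m)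

  sumTo-δ-zero : ∀ n k (f : ℕ → Carrier) → n < k → sumTo n (λ j → δ j k * f j) ≈ 0#
  sumTo-δ-zero n k f n<k =
    sumTo-zero n (λ j j≤n → trans (*-congʳ (δ-< (ℕ.≤-<-trans j≤n n<k))) (zeroˡ _))

  sumTo-δ : ∀ n k (f : ℕ → Carrier) → k ≤ n → sumTo n (λ j → δ j k * f j) ≈ f k
  sumTo-δ zero    zero    f z≤n   = *-identityˡ _
  sumTo-δ (suc n) k f k≤1+n with ℕ.m≤n⇒m<n∨m≡n k≤1+n
  ... | inj₁ (s≤s k≤n) = begin
    sumTo n (λ j → δ j k * f j) + δ (suc n) k * f (suc n)  ≈⟨ +-cong (sumTo-δ n k f k≤n) (*-congʳ (δ-> (s≤s k≤n))) ⟩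
    f k + 0# * f (suc n)                                    ≈⟨ +-congˡ (zeroˡ _) ⟩
    f k + 0#                                                ≈⟨ +-identityʳ _ ⟩
    f k                                                     ∎
  ... | inj₂ ≡.refl = begin
    sumTo n (λ j → δ j k * f j) + δ k k * f k  ≈⟨ +-cong (sumTo-δ-zero n k f ℕ.≤-refl) (*-congʳ (δ-self k)) ⟩
    0# + 1# * f k                              ≈⟨ +-identityˡ _ ⟩
    1# * f k                                   ≈⟨ *-identityˡ _ ⟩
    f k                                        ∎

  sumTo-δ-vanishing : ∀ n k (f : ℕ → Carrier) → (n < k → f k ≈ 0#) → sumTo n (λ j → δ j k * f j) ≈ f k
  sumTo-δ-vanishing n k f f≈0 with ℕ.≤-<-connex k n
  ... | inj₁ k≤n = sumTo-δ n k f k≤n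
  ... | inj₂ n<k = trans (sumTo-δ-zero n k f n<k) (sym (f≈0 n<k))

module SeriesRing {c ℓ : Level} (R : CommutativeRing c ℓ) where
  open CommutativeRing R
  open FPS R
  open Sums R
  open CommutativeSemigroupProperties *-commutativeSemigroup using (x∙yz≈y∙xz; x∙yz≈y∙zx)
  open import Relation.Binary.Reasoning.Setoid setoid

  ≈ₛ-refl : ∀ {a} → a ≈ₛ a
  ≈ₛ-refl n = refl

  ≈ₛ-sym : ∀ {a b} → a ≈ₛ b → b ≈ₛ a
  ≈ₛ-sym a≈b n = sym (a≈b n)

  ≈ₛ-trans : ∀ {a b d} → a ≈ₛ b → b ≈ₛ d → a ≈ₛ d
  ≈ₛ-trans a≈b b≈d n = trans (a≈b n) (b≈d n)

  𝟘-coeff : ∀ n → 𝟘 n ≈ 0#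
  𝟘-coeff zero    = refl
  𝟘-coeff (suc n) = refl

  ⊗-cong : ∀ {a a′ b b′} → a ≈ₛ a′ → b ≈ₛ b′ → (a ⊗ b) ≈ₛ (a′ ⊗ b′)
  ⊗-cong a≈a′ b≈b′ n = sumTo-cong n (λ i → *-cong (a≈a′ i) (b≈b′ _))

  -- _⊗_ is defined with a private copy of truncated subtraction, so it is first
  -- brought into the textbook form.
  ⊗-coeff : ∀ n a b → (a ⊗ b) n ≈ sumTo n (λ i → a i * b (n ∸ i))
  ⊗-coeff zero    a b = refl
  ⊗-coeff (suc n) a b = begin
    (a ⊗ b) (suc n)                                         ≈⟨ sumTo-suc n _ ⟩
    a 0 * b (suc n) + ((λ i → a (suc i)) ⊗ b) n             ≈⟨ +-congˡ (⊗-coeff n (λ i → a (suc i)) b) ⟩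
    a 0 * b (suc n) + sumTo n (λ i → a (suc i) * b (n ∸ i)) ≈⟨ sumTo-suc n _ ⟨
    sumTo (suc n) (λ i → a i * b (suc n ∸ i))               ∎

  ⊗-as-δ-sum : ∀ a b n N → n ≤ N →
    (a ⊗ b) n ≈ sumTo N (λ i → sumTo N (λ j → δ (i ℕ.+ j) n * (a i * b j)))
  ⊗-as-δ-sum a b n N n≤N = begin
    (a ⊗ b) n                         ≈⟨ ⊗-coeff n a b ⟩
    sumTo n (λ i → a i * b (n ∸ i))   ≈⟨ sumTo-cong-≤ n (λ i i≤n → sym (row-≤ i i≤n)) ⟩
    sumTo n row                       ≈⟨ sumTo-extend N n≤N (λ i n<i _ → row-> i n<i) ⟩
    sumTo N row                       ∎
    where
    row : ℕ → Carrier
    row i = sumTo N (λ j → δ (i ℕ.+ j) n * (a i * b j))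
    row-≤ : ∀ i → i ≤ n → row i ≈ a i * b (n ∸ i)
    row-≤ i i≤n = begin
      row i                                               ≈⟨ sumTo-cong N (λ j → *-congʳ (δ-index j)) ⟩
      sumTo N (λ j → δ j (n ∸ i) * (a i * b j))           ≈⟨ sumTo-δ N (n ∸ i) _ (ℕ.≤-trans (ℕ.m∸n≤m n i) n≤N) ⟩
      a i * b (n ∸ i)                                     ∎
      where
      δ-index : ∀ j → δ (i ℕ.+ j) n ≈ δ j (n ∸ i)
      δ-index j = trans (reflexive (≡.cong (δ (i ℕ.+ j)) (≡.sym (ℕ.m+[n∸m]≡n i≤n)))) (δ-+ˡ i j (n ∸ i))
    row-> : ∀ i → n < i → row i ≈ 0#
    row-> i n<i = sumTo-zero N (λ j _ →
      trans (*-congʳ (δ-> (ℕ.≤-trans n<i (ℕ.m≤m+n i j)))) (zeroˡ _))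

  ⊗-comm : ∀ a b → (a ⊗ b) ≈ₛ (b ⊗ a)
  ⊗-comm a b n = begin
    (a ⊗ b) n                                                    ≈⟨ ⊗-as-δ-sum a b n n ℕ.≤-refl ⟩
    sumTo n (λ i → sumTo n (λ j → δ (i ℕ.+ j) n * (a i * b j))) ≈⟨ sumTo-comm n n _ ⟩
    sumTo n (λ j → sumTo n (λ i → δ (i ℕ.+ j) n * (a i * b j))) ≈⟨ sumTo-cong n (λ j → sumTo-cong n (λ i →
                                                                     *-cong (reflexive (≡.cong (λ m → δ m n) (ℕ.+-comm i j))) (*-comm _ _))) ⟩
    sumTo n (λ j → sumTo n (λ i → δ (j ℕ.+ i) n * (b j * a i))) ≈⟨ ⊗-as-δ-sum b a n n ℕ.≤-refl ⟨
    (b ⊗ a) n                                                    ∎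

  ⊗-distribˡ : ∀ a b d → (a ⊗ (b ⊕ d)) ≈ₛ ((a ⊗ b) ⊕ (a ⊗ d))
  ⊗-distribˡ a b d n = trans (sumTo-cong n (λ i → distribˡ _ _ _)) (sumTo-+ n _ _)

  ⊗-distribʳ : ∀ a b d → ((b ⊕ d) ⊗ a) ≈ₛ ((b ⊗ a) ⊕ (d ⊗ a))
  ⊗-distribʳ a b d n = trans (sumTo-cong n (λ i → distribʳ _ _ _)) (sumTo-+ n _ _)

  ⊗-identityʳ : ∀ a → (a ⊗ 𝟙) ≈ₛ a
  ⊗-identityʳ a zero    = *-identityʳ _
  ⊗-identityʳ a (suc n) = begin
    (a ⊗ 𝟙) (suc n)                                                   ≈⟨ ⊗-coeff (suc n) a 𝟙 ⟩
    sumTo n (λ i → a i * 𝟙 (suc n ∸ i)) + a (suc n) * 𝟙 (n ∸ n)      ≈⟨ +-cong (sumTo-zero n off-diagonal) (*-congˡ 𝟙-at-0) ⟩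
    0# + a (suc n) * 1#                                               ≈⟨ +-identityˡ _ ⟩
    a (suc n) * 1#                                                    ≈⟨ *-identityʳ _ ⟩
    a (suc n)                                                         ∎
    where
    off-diagonal : ∀ i → i ≤ n → a i * 𝟙 (suc n ∸ i) ≈ 0#
    off-diagonal i i≤n = trans (*-congˡ (reflexive (≡.cong 𝟙 (ℕ.+-∸-assoc 1 i≤n)))) (zeroʳ _)
    𝟙-at-0 : 𝟙 (n ∸ n) ≈ 1#
    𝟙-at-0 = reflexive (≡.cong 𝟙 (ℕ.n∸n≡0 n))

  ⊗-identityˡ : ∀ a → (𝟙 ⊗ a) ≈ₛ a
  ⊗-identityˡ a = ≈ₛ-trans (⊗-comm 𝟙 a) (⊗-identityʳ a)

  -- Associativity goes through the symmetric triple sum Σ_{i+j+k=n} a_i b_j c_k.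
  triple : Series → Series → Series → ℕ → Carrier
  triple a b d n = sumTo n (λ i → sumTo n (λ j → sumTo n (λ k →
    δ ((i ℕ.+ j) ℕ.+ k) n * (a i * (b j * d k)))))

  triple-rotate : ∀ a b d n → triple a b d n ≈ triple b d a n
  triple-rotate a b d n = trans (sumTo-rotate₃ n _) (sumTo-cong n (λ j → sumTo-cong n (λ k → sumTo-cong n (λ i →
    *-cong (reflexive (≡.cong (λ m → δ m n) (index i j k))) (x∙yz≈y∙zx _ _ _)))))
    where
    index : ∀ i j k → (i ℕ.+ j) ℕ.+ k ≡ (j ℕ.+ k) ℕ.+ i
    index i j k = ≡.trans (ℕ.+-assoc i j k) (ℕ.+-comm i (j ℕ.+ k))

  ⊗-⊗-triple : ∀ a b d n → ((a ⊗ b) ⊗ d) n ≈ triple a b d n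
  ⊗-⊗-triple a b d n = begin
    ((a ⊗ b) ⊗ d) n
      ≈⟨ ⊗-as-δ-sum (a ⊗ b) d n n ℕ.≤-refl ⟩
    sumTo n (λ p → sumTo n (λ k → δ (p ℕ.+ k) n * ((a ⊗ b) p * d k)))
      ≈⟨ sumTo-cong-≤ n (λ p p≤n → sumTo-cong n (λ k → *-congˡ (*-congʳ (⊗-as-δ-sum a b p n p≤n)))) ⟩
    sumTo n (λ p → sumTo n (λ k → δ (p ℕ.+ k) n * (sumTo n (λ i → sumTo n (λ j → δ (i ℕ.+ j) p * (a i * b j))) * d k)))
      ≈⟨ sumTo-cong n (λ p → sumTo-cong n (λ k → expand p k)) ⟩
    sumTo n (λ p → sumTo n (λ k → sumTo n (λ i → sumTo n (λ j → δ (p ℕ.+ k) n * ((δ (i ℕ.+ j) p * (a i * b j)) * d k)))))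
      ≈⟨ trans (sumTo-rotate₄ n _) (sumTo-rotate₃ n _) ⟩
    sumTo n (λ i → sumTo n (λ j → sumTo n (λ k → sumTo n (λ p → δ (p ℕ.+ k) n * ((δ (i ℕ.+ j) p * (a i * b j)) * d k)))))
      ≈⟨ sumTo-cong n (λ i → sumTo-cong n (λ j → sumTo-cong n (λ k → collapse i j k))) ⟩
    triple a b d n
      ∎
    where
    expand : ∀ p k → δ (p ℕ.+ k) n * (sumTo n (λ i → sumTo n (λ j → δ (i ℕ.+ j) p * (a i * b j))) * d k) ≈
                     sumTo n (λ i → sumTo n (λ j → δ (p ℕ.+ k) n * ((δ (i ℕ.+ j) p * (a i * b j)) * d k)))
    expand p k = trans (*-congˡ (*-distribʳ-sumTo n _ _)) (trans (*-distribˡ-sumTo n _ _)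
      (sumTo-cong n (λ i → trans (*-congˡ (*-distribʳ-sumTo n _ _)) (*-distribˡ-sumTo n _ _))))
    collapse : ∀ i j k → sumTo n (λ p → δ (p ℕ.+ k) n * ((δ (i ℕ.+ j) p * (a i * b j)) * d k)) ≈
                         δ ((i ℕ.+ j) ℕ.+ k) n * (a i * (b j * d k))
    collapse i j k = trans (sumTo-cong n (λ p → reorder p))
      (sumTo-δ-vanishing n (i ℕ.+ j) (λ p → δ (p ℕ.+ k) n * (a i * (b j * d k)))
        (λ n<i+j → trans (*-congʳ (δ-> (ℕ.≤-trans n<i+j (ℕ.m≤m+n _ k)))) (zeroˡ _)))
      where
      reorder : ∀ p → δ (p ℕ.+ k) n * ((δ (i ℕ.+ j) p * (a i * b j)) * d k) ≈
                      δ p (i ℕ.+ j) * (δ (p ℕ.+ k) n * (a i * (b j * d k)))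
      reorder p = begin
        δ (p ℕ.+ k) n * ((δ (i ℕ.+ j) p * (a i * b j)) * d k)     ≈⟨ *-congˡ (*-assoc _ _ _) ⟩
        δ (p ℕ.+ k) n * (δ (i ℕ.+ j) p * ((a i * b j) * d k))     ≈⟨ x∙yz≈y∙xz _ _ _ ⟩
        δ (i ℕ.+ j) p * (δ (p ℕ.+ k) n * ((a i * b j) * d k))     ≈⟨ *-cong (δ-sym (i ℕ.+ j) p) (*-congˡ (*-assoc _ _ _)) ⟩
        δ p (i ℕ.+ j) * (δ (p ℕ.+ k) n * (a i * (b j * d k)))     ∎

  ⊗-assoc : ∀ a b d → ((a ⊗ b) ⊗ d) ≈ₛ (a ⊗ (b ⊗ d))
  ⊗-assoc a b d n = begin
    ((a ⊗ b) ⊗ d) n  ≈⟨ ⊗-⊗-triple a b d n ⟩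
    triple a b d n   ≈⟨ triple-rotate a b d n ⟩
    triple b d a n   ≈⟨ ⊗-⊗-triple b d a n ⟨
    ((b ⊗ d) ⊗ a) n  ≈⟨ ⊗-comm (b ⊗ d) a n ⟩
    (a ⊗ (b ⊗ d)) n  ∎

  seriesRing : CommutativeRing c ℓ
  seriesRing = record
    { Carrier = Series ; _≈_ = _≈ₛ_ ; _+_ = _⊕_ ; _*_ = _⊗_ ; -_ = ⊖_ ; 0# = 𝟘 ; 1# = 𝟙
    ; isCommutativeRing = record
      { isRing = record
        { +-isAbelianGroup = record
          { isGroup = record
            { isMonoid = record
              { isSemigroup = record
                { isMagma = record
                  { isEquivalence = record { refl = ≈ₛ-refl ; sym = ≈ₛ-sym ; trans = ≈ₛ-trans }
                  ; ∙-cong = λ a≈a′ b≈b′ n → +-cong (a≈a′ n) (b≈b′ n) }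
                ; assoc = λ a b d n → +-assoc (a n) (b n) (d n) }
              ; identity = (λ a n → trans (+-congʳ (𝟘-coeff n)) (+-identityˡ (a n)))
                         , (λ a n → trans (+-congˡ (𝟘-coeff n)) (+-identityʳ (a n))) }
            ; inverse = (λ a n → trans (-‿inverseˡ (a n)) (sym (𝟘-coeff n)))
                      , (λ a n → trans (-‿inverseʳ (a n)) (sym (𝟘-coeff n)))
            ; ⁻¹-cong = λ a≈b n → -‿cong (a≈b n) }
          ; comm = λ a b n → +-comm (a n) (b n) }
        ; *-cong = ⊗-cong
        ; *-assoc = ⊗-assoc
        ; *-identity = ⊗-identityˡ , ⊗-identityʳ
        ; distrib = ⊗-distribˡ , ⊗-distribʳ }
      ; *-comm = ⊗-comm } }

module Composition {c ℓ : Level} (R : CommutativeRing c ℓ) where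
  open CommutativeRing R
  open FPS R
  open Sums R
  open SeriesRing R
  open CommutativeSemigroupProperties *-commutativeSemigroup using (interchange)
  open AbelianGroupProperties +-abelianGroup using () renaming (∙-cancelˡ to +-cancelˡ)
  open import Relation.Binary.Reasoning.Setoid setoid

  ^ₛ-cong : ∀ {f f′} → f ≈ₛ f′ → ∀ k → (f ^ₛ k) ≈ₛ (f′ ^ₛ k)
  ^ₛ-cong f≈f′ zero    = ≈ₛ-refl
  ^ₛ-cong f≈f′ (suc k) = ⊗-cong f≈f′ (^ₛ-cong f≈f′ k)

  ^ₛ-+ : ∀ f k l → (f ^ₛ (k ℕ.+ l)) ≈ₛ ((f ^ₛ k) ⊗ (f ^ₛ l))
  ^ₛ-+ f zero    l = ≈ₛ-sym (⊗-identityˡ _)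
  ^ₛ-+ f (suc k) l = ≈ₛ-trans (⊗-cong ≈ₛ-refl (^ₛ-+ f k l)) (≈ₛ-sym (⊗-assoc f (f ^ₛ k) (f ^ₛ l)))

  ^ₛ-below-order : ∀ {f} → f 0 ≈ 0# → ∀ {k n} → n < k → (f ^ₛ k) n ≈ 0#
  ^ₛ-below-order {f} f₀ {suc k} {n} (s≤s n≤k) = trans (⊗-coeff n f (f ^ₛ k)) (sumTo-zero n term)
    where
    term : ∀ i → i ≤ n → f i * (f ^ₛ k) (n ∸ i) ≈ 0#
    term zero    _     = trans (*-congʳ f₀) (zeroˡ _)
    term (suc i) i<n   = trans (*-congˡ (^ₛ-below-order f₀ (ℕ.<-≤-trans (ℕ.∸-monoʳ-< (s≤s z≤n) i<n) n≤k))) (zeroʳ _)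

  ^ₛ-diagonal : ∀ {w} → w 0 ≈ 0# → w 1 ≈ 1# → ∀ k → (w ^ₛ k) k ≈ 1#
  ^ₛ-diagonal w₀ w₁ zero = refl
  ^ₛ-diagonal {w} w₀ w₁ (suc k) = begin
    (w ^ₛ suc k) (suc k)                                                    ≈⟨ ⊗-coeff (suc k) w (w ^ₛ k) ⟩
    sumTo (suc k) (λ i → w i * (w ^ₛ k) (suc k ∸ i))                         ≈⟨ sumTo-suc k _ ⟩
    w 0 * (w ^ₛ k) (suc k) + sumTo k (λ i → w (suc i) * (w ^ₛ k) (k ∸ i))    ≈⟨ +-cong (trans (*-congʳ w₀) (zeroˡ _)) (sym (sumTo-extend k z≤n higher)) ⟩
    0# + w 1 * (w ^ₛ k) k                                                    ≈⟨ +-identityˡ _ ⟩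
    w 1 * (w ^ₛ k) k                                                         ≈⟨ *-cong w₁ (^ₛ-diagonal w₀ w₁ k) ⟩
    1# * 1#                                                                  ≈⟨ *-identityˡ 1# ⟩
    1#                                                                       ∎
    where
    higher : ∀ i → 0 < i → i ≤ k → w (suc i) * (w ^ₛ k) (k ∸ i) ≈ 0#
    higher i 0<i i≤k = trans (*-congˡ (^ₛ-below-order w₀ (ℕ.∸-monoʳ-< 0<i i≤k))) (zeroʳ _)

  ∘ₛ-truncate : ∀ {f} → f 0 ≈ 0# → ∀ a {n} N → n ≤ N → (a ∘ₛ f) n ≈ sumTo N (λ k → a k * (f ^ₛ k) n)
  ∘ₛ-truncate f₀ a N n≤N = sumTo-extend N n≤N (λ k n<k _ → trans (*-congˡ (^ₛ-below-order f₀ n<k)) (zeroʳ _))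

  ∘ₛ-cong : ∀ {a a′ f f′} → a ≈ₛ a′ → f ≈ₛ f′ → (a ∘ₛ f) ≈ₛ (a′ ∘ₛ f′)
  ∘ₛ-cong a≈a′ f≈f′ n = sumTo-cong n (λ k → *-cong (a≈a′ k) (^ₛ-cong f≈f′ k n))

  ⊕-∘ₛ : ∀ a b f → ((a ⊕ b) ∘ₛ f) ≈ₛ ((a ∘ₛ f) ⊕ (b ∘ₛ f))
  ⊕-∘ₛ a b f n = trans (sumTo-cong n (λ k → distribʳ _ _ _)) (sumTo-+ n _ _)

  𝟙-∘ₛ : ∀ f → (𝟙 ∘ₛ f) ≈ₛ 𝟙
  𝟙-∘ₛ f n = begin
    (𝟙 ∘ₛ f) n  ≈⟨ sumTo-extend n z≤n (λ { (suc k) _ _ → zeroˡ _ }) ⟨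
    1# * 𝟙 n    ≈⟨ *-identityˡ _ ⟩
    𝟙 n         ∎

  X-∘ₛ : ∀ {f} → f 0 ≈ 0# → (X ∘ₛ f) ≈ₛ f
  X-∘ₛ f₀ zero = trans (zeroˡ _) (sym f₀)
  X-∘ₛ {f} f₀ (suc n) = begin
    (X ∘ₛ f) (suc n)                         ≈⟨ sumTo-extend (suc n) (s≤s z≤n) beyond-X₁ ⟨
    0# * 𝟙 (suc n) + 1# * (f ⊗ 𝟙) (suc n)    ≈⟨ +-cong (zeroˡ _) (*-identityˡ _) ⟩
    0# + (f ⊗ 𝟙) (suc n)                     ≈⟨ +-identityˡ _ ⟩
    (f ⊗ 𝟙) (suc n)                          ≈⟨ ⊗-identityʳ f (suc n) ⟩
    f (suc n)                                ∎
    where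
    beyond-X₁ : ∀ k → 1 < k → k ≤ suc n → X k * (f ^ₛ k) (suc n) ≈ 0#
    beyond-X₁ (suc zero)    (s≤s ()) _
    beyond-X₁ (suc (suc k)) _        _ = zeroˡ _

  ⊗-∘ₛ : ∀ {f} → f 0 ≈ 0# → ∀ a b → ((a ⊗ b) ∘ₛ f) ≈ₛ ((a ∘ₛ f) ⊗ (b ∘ₛ f))
  ⊗-∘ₛ {f} f₀ a b n = trans composite-side (sym product-side)
    where
    expanded : Carrier
    expanded = sumTo n (λ k → sumTo n (λ l → (a k * b l) * (f ^ₛ (k ℕ.+ l)) n))

    composite-side : ((a ⊗ b) ∘ₛ f) n ≈ expanded
    composite-side = begin
      ((a ⊗ b) ∘ₛ f) n
        ≈⟨ sumTo-cong-≤ n (λ m m≤n → *-congʳ (⊗-as-δ-sum a b m n m≤n)) ⟩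
      sumTo n (λ m → sumTo n (λ k → sumTo n (λ l → δ (k ℕ.+ l) m * (a k * b l))) * (f ^ₛ m) n)
        ≈⟨ sumTo-cong n (λ m → trans (*-distribʳ-sumTo n _ _) (sumTo-cong n (λ k → *-distribʳ-sumTo n _ _))) ⟩
      sumTo n (λ m → sumTo n (λ k → sumTo n (λ l → (δ (k ℕ.+ l) m * (a k * b l)) * (f ^ₛ m) n)))
        ≈⟨ sumTo-rotate₃ n _ ⟩
      sumTo n (λ k → sumTo n (λ l → sumTo n (λ m → (δ (k ℕ.+ l) m * (a k * b l)) * (f ^ₛ m) n)))
        ≈⟨ sumTo-cong n (λ k → sumTo-cong n (λ l → collapse k l)) ⟩
      expanded ∎
      where
      collapse : ∀ k l → sumTo n (λ m → (δ (k ℕ.+ l) m * (a k * b l)) * (f ^ₛ m) n) ≈ (a k * b l) * (f ^ₛ (k ℕ.+ l)) n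
      collapse k l = trans (sumTo-cong n (λ m → trans (*-congʳ (*-congʳ (δ-sym (k ℕ.+ l) m))) (*-assoc _ _ _)))
        (sumTo-δ-vanishing n (k ℕ.+ l) (λ m → (a k * b l) * (f ^ₛ m) n)
          (λ n<k+l → trans (*-congˡ (^ₛ-below-order f₀ n<k+l)) (zeroʳ _)))

    product-side : ((a ∘ₛ f) ⊗ (b ∘ₛ f)) n ≈ expanded
    product-side = begin
      ((a ∘ₛ f) ⊗ (b ∘ₛ f)) n
        ≈⟨ ⊗-coeff n (a ∘ₛ f) (b ∘ₛ f) ⟩
      sumTo n (λ i → (a ∘ₛ f) i * (b ∘ₛ f) (n ∸ i))
        ≈⟨ sumTo-cong-≤ n (λ i i≤n → *-cong (∘ₛ-truncate f₀ a n i≤n) (∘ₛ-truncate f₀ b n (ℕ.m∸n≤m n i))) ⟩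
      sumTo n (λ i → sumTo n (λ k → a k * (f ^ₛ k) i) * sumTo n (λ l → b l * (f ^ₛ l) (n ∸ i)))
        ≈⟨ sumTo-cong n (λ i → sumTo-*-sumTo n n _ _) ⟩
      sumTo n (λ i → sumTo n (λ k → sumTo n (λ l → (a k * (f ^ₛ k) i) * (b l * (f ^ₛ l) (n ∸ i)))))
        ≈⟨ sumTo-rotate₃ n _ ⟩
      sumTo n (λ k → sumTo n (λ l → sumTo n (λ i → (a k * (f ^ₛ k) i) * (b l * (f ^ₛ l) (n ∸ i)))))
        ≈⟨ sumTo-cong n (λ k → sumTo-cong n (λ l → power-product k l)) ⟩
      expanded ∎
      where
      power-product : ∀ k l → sumTo n (λ i → (a k * (f ^ₛ k) i) * (b l * (f ^ₛ l) (n ∸ i))) ≈ (a k * b l) * (f ^ₛ (k ℕ.+ l)) n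
      power-product k l = begin
        sumTo n (λ i → (a k * (f ^ₛ k) i) * (b l * (f ^ₛ l) (n ∸ i)))  ≈⟨ sumTo-cong n (λ i → interchange _ _ _ _) ⟩
        sumTo n (λ i → (a k * b l) * ((f ^ₛ k) i * (f ^ₛ l) (n ∸ i)))  ≈⟨ *-distribˡ-sumTo n _ _ ⟨
        (a k * b l) * sumTo n (λ i → (f ^ₛ k) i * (f ^ₛ l) (n ∸ i))    ≈⟨ *-congˡ (⊗-coeff n (f ^ₛ k) (f ^ₛ l)) ⟨
        (a k * b l) * ((f ^ₛ k) ⊗ (f ^ₛ l)) n                          ≈⟨ *-congˡ (^ₛ-+ f k l n) ⟨
        (a k * b l) * (f ^ₛ (k ℕ.+ l)) n                               ∎

  ^ₛ-∘ₛ : ∀ {a f} → f 0 ≈ 0# → ∀ k → ((a ∘ₛ f) ^ₛ k) ≈ₛ ((a ^ₛ k) ∘ₛ f)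
  ^ₛ-∘ₛ {a} {f} f₀ zero    = ≈ₛ-sym (𝟙-∘ₛ f)
  ^ₛ-∘ₛ {a} {f} f₀ (suc k) = ≈ₛ-trans (⊗-cong ≈ₛ-refl (^ₛ-∘ₛ f₀ k)) (≈ₛ-sym (⊗-∘ₛ f₀ a (a ^ₛ k)))

  ∘ₛ-assoc : ∀ {u f} → u 0 ≈ 0# → f 0 ≈ 0# → ∀ a → ((a ∘ₛ u) ∘ₛ f) ≈ₛ (a ∘ₛ (u ∘ₛ f))
  ∘ₛ-assoc {u} {f} u₀ f₀ a n = begin
    ((a ∘ₛ u) ∘ₛ f) n                                                ≈⟨ sumTo-cong-≤ n (λ m m≤n → *-congʳ (∘ₛ-truncate u₀ a n m≤n)) ⟩
    sumTo n (λ m → sumTo n (λ k → a k * (u ^ₛ k) m) * (f ^ₛ m) n)    ≈⟨ sumTo-cong n (λ m → *-distribʳ-sumTo n _ _) ⟩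
    sumTo n (λ m → sumTo n (λ k → (a k * (u ^ₛ k) m) * (f ^ₛ m) n))  ≈⟨ sumTo-comm n n _ ⟩
    sumTo n (λ k → sumTo n (λ m → (a k * (u ^ₛ k) m) * (f ^ₛ m) n))  ≈⟨ sumTo-cong n (λ k → trans (sumTo-cong n (λ m → *-assoc _ _ _)) (sym (*-distribˡ-sumTo n _ _))) ⟩
    sumTo n (λ k → a k * ((u ^ₛ k) ∘ₛ f) n)                          ≈⟨ sumTo-cong n (λ k → *-congˡ (^ₛ-∘ₛ f₀ k n)) ⟨
    (a ∘ₛ (u ∘ₛ f)) n                                                ∎

  ≈ₛ-induction : ∀ {a b} → a 0 ≈ b 0 →
    (∀ n → (∀ i → i ≤ n → a i ≈ b i) → a (suc n) ≈ b (suc n)) → a ≈ₛ b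
  ≈ₛ-induction {a} {b} base step n = up-to n n ℕ.≤-refl
    where
    up-to : ∀ n i → i ≤ n → a i ≈ b i
    up-to zero    zero z≤n = base
    up-to (suc n) i i≤1+n with ℕ.m≤n⇒m<n∨m≡n i≤1+n
    ... | inj₁ (s≤s i≤n) = up-to n i i≤n
    ... | inj₂ ≡.refl   = step n (up-to n)

  *-cancelʳ-invertible : ∀ {x y z u} → z * u ≈ 1# → x * z ≈ y * z → x ≈ y
  *-cancelʳ-invertible {x} {y} {z} {u} zu≈1 xz≈yz = begin
    x             ≈⟨ *-identityʳ x ⟨
    x * 1#        ≈⟨ *-congˡ zu≈1 ⟨
    x * (z * u)   ≈⟨ *-assoc x z u ⟨
    (x * z) * u   ≈⟨ *-congʳ xz≈yz ⟩
    (y * z) * u   ≈⟨ *-assoc y z u ⟩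
    y * (z * u)   ≈⟨ *-congˡ zu≈1 ⟩
    y * 1#        ≈⟨ *-identityʳ y ⟩
    y             ∎

  ⊗-cancelʳ : ∀ {a b d u} → d 0 * u ≈ 1# → (a ⊗ d) ≈ₛ (b ⊗ d) → a ≈ₛ b
  ⊗-cancelʳ {a} {b} {d} d₀u≈1 ad≈bd = ≈ₛ-induction (*-cancelʳ-invertible d₀u≈1 (ad≈bd 0)) step
    where
    step : ∀ n → (∀ i → i ≤ n → a i ≈ b i) → a (suc n) ≈ b (suc n)
    step n a≈b = *-cancelʳ-invertible (trans (*-congʳ (reflexive (≡.cong d (ℕ.n∸n≡0 n)))) d₀u≈1)
      (+-cancelˡ (sumTo n (λ i → b i * d (suc n ∸ i))) _ _ (begin
        sumTo n (λ i → b i * d (suc n ∸ i)) + a (suc n) * d (n ∸ n)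
          ≈⟨ +-congʳ (sumTo-cong-≤ n (λ i i≤n → *-congʳ (a≈b i i≤n))) ⟨
        sumTo (suc n) (λ i → a i * d (suc n ∸ i))  ≈⟨ ⊗-coeff (suc n) a d ⟨
        (a ⊗ d) (suc n)                            ≈⟨ ad≈bd (suc n) ⟩
        (b ⊗ d) (suc n)                            ≈⟨ ⊗-coeff (suc n) b d ⟩
        sumTo (suc n) (λ i → b i * d (suc n ∸ i))  ∎))

  ∘ₛ-injective : ∀ {a b w} → w 0 ≈ 0# → w 1 ≈ 1# → (a ∘ₛ w) ≈ₛ (b ∘ₛ w) → a ≈ₛ b
  ∘ₛ-injective {a} {b} {w} w₀ w₁ aw≈bw = ≈ₛ-induction (*-cancelʳ-invertible (*-identityʳ 1#) (aw≈bw 0)) step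
    where
    step : ∀ n → (∀ i → i ≤ n → a i ≈ b i) → a (suc n) ≈ b (suc n)
    step n a≈b = *-cancelʳ-invertible (trans (*-identityʳ _) (^ₛ-diagonal w₀ w₁ (suc n)))
      (+-cancelˡ (sumTo n (λ k → b k * (w ^ₛ k) (suc n))) _ _
        (trans (+-congʳ (sumTo-cong-≤ n (λ k k≤n → *-congʳ (sym (a≈b k k≤n))))) (aw≈bw (suc n))))

module HyperbolicSquare {c ℓ : Level} (R : CommutativeRing c ℓ) where
  open CommutativeRing R
  open AbelianGroupProperties +-abelianGroup using () renaming (∙-cancelʳ to +-cancelʳ)
  open NaturalSolver commutativeSemiring
  open import Relation.Binary.Reasoning.Setoid setoid

  -- Think of r = eᵘ, s = sinh u, t = cosh u; s * s is added to both sides so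
  -- that the expansion is a semiring identity.
  square-of-sinh+cosh : ∀ {r s t} → r ≈ s + t → t * t ≈ s * s + 1# → r * r ≈ 1# + r * (s + s)
  square-of-sinh+cosh {r} {s} {t} r≈s+t t²≈s²+1 = +-cancelʳ (s * s) _ _ (begin
    r * r + s * s               ≈⟨ +-congʳ (*-cong r≈s+t r≈s+t) ⟩
    (s + t) * (s + t) + s * s   ≈⟨ solve 2 (λ s t → (s :+ t) :* (s :+ t) :+ s :* s := t :* t :+ (s :+ t) :* (s :+ s)) refl s t ⟩
    t * t + (s + t) * (s + s)   ≈⟨ +-cong t²≈s²+1 (*-congʳ (sym r≈s+t)) ⟩
    (s * s + 1#) + r * (s + s)  ≈⟨ solve 3 (λ a b d → (a :+ b) :+ d := (b :+ d) :+ a) refl (s * s) 1# (r * (s + s)) ⟩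
    (1# + r * (s + s)) + s * s  ∎)

module BFunctionIdentity {c ℓ : Level} (R : CommutativeRing c ℓ) where
  open CommutativeRing R using (_≈_; 0#; zeroˡ; *-identityˡ; *-identityʳ; +-identityˡ; +-cong; trans)
  open FPS R
  open SeriesRing R
  open Composition R
  open CommutativeRing seriesRing using (setoid) renaming (+-abelianGroup to ⊕-abelianGroup; +-cong to ⊕-cong; +-congˡ to ⊕-congˡ)
  open AbelianGroupProperties ⊕-abelianGroup using () renaming (∙-cancelˡ to ⊕-cancelˡ)
  open HyperbolicSquare seriesRing using (square-of-sinh+cosh)
  open NaturalSolver (CommutativeRing.commutativeSemiring seriesRing)
  open import Relation.Binary.Reasoning.Setoid setoid

  X⊗-coeff-0 : ∀ a → (X ⊗ a) 0 ≈ 0#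
  X⊗-coeff-0 a = zeroˡ _

  X⊗-coeff-1 : ∀ a → (X ⊗ a) 1 ≈ a 0
  X⊗-coeff-1 a = trans (+-cong (zeroˡ _) (*-identityˡ _)) (+-identityˡ _)

  x·B[x²]-∘ₛ : ∀ {w} → w 0 ≈ 0# → ∀ B → ((X ⊗ (B ∘ₛ (X ⊗ X))) ∘ₛ w) ≈ₛ (w ⊗ (B ∘ₛ (w ⊗ w)))
  x·B[x²]-∘ₛ {w} w₀ B = begin
    (X ⊗ (B ∘ₛ (X ⊗ X))) ∘ₛ w          ≈⟨ ⊗-∘ₛ w₀ X (B ∘ₛ (X ⊗ X)) ⟩
    (X ∘ₛ w) ⊗ ((B ∘ₛ (X ⊗ X)) ∘ₛ w)   ≈⟨ ⊗-cong (X-∘ₛ w₀) (∘ₛ-assoc (X⊗-coeff-0 X) w₀ B) ⟩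
    w ⊗ (B ∘ₛ ((X ⊗ X) ∘ₛ w))          ≈⟨ ⊗-cong ≈ₛ-refl (∘ₛ-cong ≈ₛ-refl x²∘w≈w²) ⟩
    w ⊗ (B ∘ₛ (w ⊗ w))                 ∎
    where
    x²∘w≈w² : ((X ⊗ X) ∘ₛ w) ≈ₛ (w ⊗ w)
    x²∘w≈w² = ≈ₛ-trans (⊗-∘ₛ w₀ X X) (⊗-cong (X-∘ₛ w₀) (X-∘ₛ w₀))

  B-equation-at-x√g : ∀ {g B r} → IsBFunction g B → (r ⊗ r) ≈ₛ g →
    g ≈ₛ (𝟙 ⊕ (r ⊗ ((X ⊗ r) ⊗ (B ∘ₛ ((X ⊗ r) ⊗ (X ⊗ r))))))
  B-equation-at-x√g {g} {B} {r} isB r²≈g = begin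
    g                                                  ≈⟨ isB ⟩
    𝟙 ⊕ ((X ⊗ g) ⊗ (B ∘ₛ ((X ⊗ X) ⊗ g)))               ≈⟨ ⊕-congˡ (⊗-cong (⊗-cong ≈ₛ-refl g≈r²) (∘ₛ-cong ≈ₛ-refl x²g≈w²)) ⟩
    𝟙 ⊕ ((X ⊗ (r ⊗ r)) ⊗ (B ∘ₛ ((X ⊗ r) ⊗ (X ⊗ r))))   ≈⟨ ⊕-congˡ (solve 3 (λ x ρ k → (x :* (ρ :* ρ)) :* k := ρ :* ((x :* ρ) :* k)) ≈ₛ-refl X r (B ∘ₛ ((X ⊗ r) ⊗ (X ⊗ r)))) ⟩
    𝟙 ⊕ (r ⊗ ((X ⊗ r) ⊗ (B ∘ₛ ((X ⊗ r) ⊗ (X ⊗ r)))))   ∎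
    where
    g≈r² : g ≈ₛ (r ⊗ r)
    g≈r² = ≈ₛ-sym r²≈g
    x²g≈w² : ((X ⊗ X) ⊗ g) ≈ₛ ((X ⊗ r) ⊗ (X ⊗ r))
    x²g≈w² = ≈ₛ-trans (⊗-cong ≈ₛ-refl g≈r²) (solve 2 (λ x ρ → (x :* x) :* (ρ :* ρ) := (x :* ρ) :* (x :* ρ)) ≈ₛ-refl X r)

  square-via-A-sequence : ∀ {r h s t} → (h ∘ₛ (X ⊗ r)) ≈ₛ r → (t ⊗ t) ≈ₛ ((s ⊗ s) ⊕ 𝟙) → h ≈ₛ (s ⊕ t) →
    (r ⊗ r) ≈ₛ (𝟙 ⊕ (r ⊗ ((s ∘ₛ (X ⊗ r)) ⊕ (s ∘ₛ (X ⊗ r)))))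
  square-via-A-sequence {r} {h} {s} {t} h∘w≈r t²≈s²+1 h≈s+t = square-of-sinh+cosh r≈S+T T²≈S²+1
    where
    w : Series
    w = X ⊗ r
    r≈S+T : r ≈ₛ ((s ∘ₛ w) ⊕ (t ∘ₛ w))
    r≈S+T = begin
      r                         ≈⟨ h∘w≈r ⟨
      h ∘ₛ w                    ≈⟨ ∘ₛ-cong h≈s+t ≈ₛ-refl ⟩
      (s ⊕ t) ∘ₛ w              ≈⟨ ⊕-∘ₛ s t w ⟩
      (s ∘ₛ w) ⊕ (t ∘ₛ w)       ∎
    T²≈S²+1 : ((t ∘ₛ w) ⊗ (t ∘ₛ w)) ≈ₛ (((s ∘ₛ w) ⊗ (s ∘ₛ w)) ⊕ 𝟙)
    T²≈S²+1 = begin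
      (t ∘ₛ w) ⊗ (t ∘ₛ w)            ≈⟨ ⊗-∘ₛ (X⊗-coeff-0 r) t t ⟨
      (t ⊗ t) ∘ₛ w                   ≈⟨ ∘ₛ-cong t²≈s²+1 ≈ₛ-refl ⟩
      ((s ⊗ s) ⊕ 𝟙) ∘ₛ w             ≈⟨ ⊕-∘ₛ (s ⊗ s) 𝟙 w ⟩
      ((s ⊗ s) ∘ₛ w) ⊕ (𝟙 ∘ₛ w)      ≈⟨ ⊕-cong (⊗-∘ₛ (X⊗-coeff-0 r) s s) (𝟙-∘ₛ w) ⟩
      ((s ∘ₛ w) ⊗ (s ∘ₛ w)) ⊕ 𝟙      ∎

  s⊕s-∘ₛ-x√g : ∀ {g B r h s t} → IsBFunction g B → IsSqrt1 g r →
    (h ∘ₛ (X ⊗ r)) ≈ₛ r → (t ⊗ t) ≈ₛ ((s ⊗ s) ⊕ 𝟙) → h ≈ₛ (s ⊕ t) →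
    ((s ⊕ s) ∘ₛ (X ⊗ r)) ≈ₛ ((X ⊗ r) ⊗ (B ∘ₛ ((X ⊗ r) ⊗ (X ⊗ r))))
  s⊕s-∘ₛ-x√g {g} {B} {r} {h} {s} {t} isB (r₀ , r²≈g) h∘w≈r t²≈s²+1 h≈s+t =
    ⊗-cancelʳ {d = r} (trans (*-identityʳ _) r₀) (begin
      ((s ⊕ s) ∘ₛ w) ⊗ r    ≈⟨ ⊗-comm ((s ⊕ s) ∘ₛ w) r ⟩
      r ⊗ ((s ⊕ s) ∘ₛ w)    ≈⟨ ⊗-cong ≈ₛ-refl (⊕-∘ₛ s s w) ⟩
      r ⊗ (S ⊕ S)           ≈⟨ ⊕-cancelˡ 𝟙 _ _ 𝟙+r[S+S]≈𝟙+r[wK] ⟩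
      r ⊗ (w ⊗ K)           ≈⟨ ⊗-comm r (w ⊗ K) ⟩
      (w ⊗ K) ⊗ r           ∎)
    where
    w S K : Series
    w = X ⊗ r
    S = s ∘ₛ w
    K = B ∘ₛ (w ⊗ w)
    𝟙+r[S+S]≈𝟙+r[wK] : (𝟙 ⊕ (r ⊗ (S ⊕ S))) ≈ₛ (𝟙 ⊕ (r ⊗ (w ⊗ K)))
    𝟙+r[S+S]≈𝟙+r[wK] = ≈ₛ-trans (≈ₛ-sym (square-via-A-sequence h∘w≈r t²≈s²+1 h≈s+t))
                                 (≈ₛ-trans r²≈g (B-equation-at-x√g isB r²≈g))

theorem2p2 : {c ℓ : Level} (R : CommutativeRing c ℓ) → IsFieldChar0 R →
    let open FPS R in
    (g B r h s t : Series) →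
    IsPseudoInvolution g →
    IsBFunction g B →
    IsSqrt1 g r →
    (h ∘ₛ (X ⊗ r)) ≈ₛ r →
    IsSqrt1 ((s ⊗ s) ⊕ 𝟙) t →
    h ≈ₛ (s ⊕ t) →
    (X ⊗ (B ∘ₛ (X ⊗ X))) ≈ₛ (s ⊕ s)
theorem2p2 R _ g B r h s t _ isB √g@(r₀ , _) h∘w≈r (_ , t²≈s²+1) h≈s+t =
  ∘ₛ-injective w₀ (trans (X⊗-coeff-1 r) r₀)
    (≈ₛ-trans (x·B[x²]-∘ₛ w₀ B) (≈ₛ-sym (s⊕s-∘ₛ-x√g isB √g h∘w≈r t²≈s²+1 h≈s+t)))
  where
  open CommutativeRing R using (_≈_; 0#; trans)
  open FPS R
  open SeriesRing R using (≈ₛ-trans; ≈ₛ-sym)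
  open Composition R using (∘ₛ-injective)
  open BFunctionIdentity R
  w₀ : (X ⊗ r) 0 ≈ 0#
  w₀ = X⊗-coeff-0 r
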